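{- For all terms $s,t,u$ and every $R \in \{\approx, \sqsupseteq, \sqsupset, \sqsupset\!\!\sqsupset\}$: if $s \approx t$ and $t\ R\ u$, then $s\ R\ u$.
   Context: Simply typed terms: there is a single base type (sort) $\iota$; types are $\iota$ and $\sigma \Rightarrow \tau$. Given a set of typed variables (infinitely many of each type) and a possibly infinite set of typed function symbols, terms are built from variables and function symbols by type-respecting application: if $s :: \sigma \Rightarrow \tau$ and $t :: \sigma$ then $s\ t :: \tau$ (left-associative). Every term has the form $a\ s_1 \cdots s_n$ ($n\ge 0$) with $a$ a variable or function symbol. Fixed data: a precedence $\unrhd$ (a quasi-ordering on function symbols whose strict part $\rhd$ is well-founded; $\equiv$ denotes $\unrhd \cap \unlhd$), and a filter $\pi$ assigning to each $\mathsf{f} :: \sigma_1 \Rightarrow \dots \Rightarrow \sigma_m \Rightarrow \iota$ a set $\pi(\mathsf{f}) \subseteq \{1,\dots,m\}$; for each $\mathsf{f}$ the arities of the symbols $\mathsf{g} \equiv \mathsf{f}$ are bounded. Equivalence: $s \approx t$ iff $s,t$ have the same type and either (Eq-mono) $s = x\ s_1 \cdots s_n$, $t = x\ t_1 \cdots t_n$, $x$ a variable, $s_i \approx t_i$ for all $i$; or (Eq-args) $s = \mathsf{f}\ s_1 \cdots s_n$, $t = \mathsf{g}\ t_1 \cdots t_n$, $\mathsf{f},\mathsf{g}$ function symbols of the same type, $\mathsf{f} \equiv \mathsf{g}$, $\pi(\mathsf{f}) = \pi(\mathsf{g})$, $s_i \approx t_i$ for all $i \in \pi(\mathsf{f}) \cap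 \{1,\dots,n\}$. The relations $\sqsupseteq, \sqsupset, \sqsupset\!\!\sqsupset$ are the least relations such that: $s \sqsupseteq t$ iff $s \approx t$ or $s \sqsupset t$. $s \sqsupset t$ if $s,t$ have the same type and one of: (Gr-mono) $s = x\ s_1 \cdots s_n$, $t = x\ t_1 \cdots t_n$, $x$ a variable, $s_i \sqsupseteq t_i$ for all $i$ and $s_i \sqsupset t_i$ for some $i$; (Gr-args) $s = \mathsf{f}\ s_1 \cdots s_n$, $t = \mathsf{g}\ t_1 \cdots t_n$, $\mathsf{f},\mathsf{g}$ of the same type, $\mathsf{f} \equiv \mathsf{g}$, $\pi(\mathsf{f}) = \pi(\mathsf{g})$, $s_i \sqsupseteq t_i$ for all $i \in \pi(\mathsf{f}) \cap \{1,\dots,n\}$ and $s_i \sqsupset t_i$ for some such $i$; (Gr-rpo) $s \sqsupset\!\!\sqsupset t$. $s \sqsupset\!\!\sqsupset t$ ($s,t$ possibly of different types) if $s = \mathsf{f}\ s_1 \cdots s_n$ with $\mathsf{f} :: \sigma_1 \Rightarrow \dots \Rightarrow \sigma_m \Rightarrow \iota$, $\{n+1,\dots,m\} \subseteq \pi(\mathsf{f})$, and one of: (Rpo-select) $s_i \sqsupseteq t$ for some $i \in \pi(\mathsf{f}) \cap \{1,\dots,n\}$; (Rpo-appl) $t = t_0\ t_1 \cdots t_k$ with $k \ge 1$ and $s \sqsupset\!\!\sqsupset t_i$ for all $0 \le i \le k$; (Rpo-copy) $t = \mathsf{g}\ t_1 \cdots t_k$ with $\mathsf{f} \rhd \mathsf{g}$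 and $s \sqsupset\!\!\sqsupset t_i$ for all $i \in \pi(\mathsf{g}) \cap \{1,\dots,k\}$; (Rpo-lex) $t = \mathsf{g}\ t_1 \cdots t_k$ with $\mathsf{f} \equiv \mathsf{g}$ and there is $i \in \pi(\mathsf{f}) \cap \pi(\mathsf{g}) \cap \{1,\dots,\min(n,k)\}$ with $\pi(\mathsf{f}) \cap \{1,\dots,i\} = \pi(\mathsf{g}) \cap \{1,\dots,i\}$, $s_j \approx t_j$ for all $j \in \{1,\dots,i-1\} \cap \pi(\mathsf{f})$, $s_i \sqsupset t_i$, and $s \sqsupset\!\!\sqsupset t_j$ for all $j \in \{i+1,\dots,k\} \cap \pi(\mathsf{g})$. -}

module Defs where

open import Data.Nat using (ℕ; zero; suc; _≤_; _<_)
open import Data.Bool using (Bool; true)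
open import Data.List using (List; []; _∷_; length; _++_)
open import Data.List.Relation.Unary.All using (All)
open import Data.Maybe using (Maybe; just; nothing)
open import Data.Product using (Σ; _×_; _,_)
open import Relation.Nullary using (¬_)
open import Relation.Binary.PropositionalEquality using (_≡_)
open import Induction.WellFounded using (WellFounded)

infixr 5 _⇒_

data Ty : Set where
  ι   : Ty
  _⇒_ : Ty → Ty → Ty

arity : Ty → ℕ
arity ι       = 0
arity (_ ⇒ τ) = suc (arity τ)

record Setting : Set₁ where
  field
    Var           : Set
    vtype         : Var → Ty
    vars-infinite : ∀ σ → Σ (ℕ → Var) λ v →
                      (∀ n → vtype (v n) ≡ σ) × (∀ m n → v m ≡ v n → m ≡ n)
    Fun           : Set
    ftype         : Fun → Ty
    _⊵_           : Fun → Fun → Set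
    ⊵-refl        : ∀ {f} → f ⊵ f
    ⊵-trans       : ∀ {f g h} → f ⊵ g → g ⊵ h → f ⊵ h
    ▷-wf          : WellFounded (λ g f → (f ⊵ g) × ¬ (g ⊵ f))
    arity-bounded : ∀ f → Σ ℕ λ B → ∀ g → (g ⊵ f) × (f ⊵ g) → arity (ftype g) ≤ B
    -- filter: π f i ≡ true means i ∈ π(f); π(f) ⊆ {1,…,m}
    π             : Fun → ℕ → Bool
    π-bound       : ∀ f i → π f i ≡ true → (1 ≤ i) × (i ≤ arity (ftype f))

-- 1-based indexing: xs ‼ i ≡ just a  iff  1 ≤ i ≤ length xs and a is the i-th element.
_‼_ : {A : Set} → List A → ℕ → Maybe A
[]       ‼ _             = nothing
(x ∷ xs) ‼ zero          = nothing
(x ∷ xs) ‼ suc zero      = just x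
(x ∷ xs) ‼ suc (suc i)   = xs ‼ suc i

module Terms (S : Setting) where
  open Setting S

  _▷_ : Fun → Fun → Set
  f ▷ g = (f ⊵ g) × ¬ (g ⊵ f)

  _≋_ : Fun → Fun → Set
  f ≋ g = (f ⊵ g) × (g ⊵ f)

  data Head : Set where
    var : Var → Head
    fun : Fun → Head

  headTy : Head → Ty
  headTy (var x) = vtype x
  headTy (fun f) = ftype f

  -- A term in applicative (spine) form  a s₁ ⋯ sₙ.
  infixl 9 _$_
  data Tm : Set where
    _$_ : Head → List Tm → Tm

  data _∶_ : Tm → Ty → Set
  data SpineTy : Ty → List Tm → Ty → Set

  data SpineTy where
    []  : ∀ {σ} → SpineTy σ [] σ
    _∷_ : ∀ {σ τ ρ t ts} → t ∶ σ → SpineTy τ ts ρ → SpineTy (σ ⇒ τ) (t ∷ ts) ρ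

  data _∶_ where
    tm : ∀ {h ts σ} → SpineTy (headTy h) ts σ → (h $ ts) ∶ σ

  SameTy : Tm → Tm → Set
  SameTy s t = Σ Ty λ σ → (s ∶ σ) × (t ∶ σ)

  infix 4 _≈_ _⊒_ _⊐_ _⊐⊐_
  data _≈_ : Tm → Tm → Set where
    eq-mono : ∀ {x ss ts} → SameTy (var x $ ss) (var x $ ts) → length ss ≡ length ts →
              (∀ i a b → ss ‼ i ≡ just a → ts ‼ i ≡ just b → a ≈ b) →
              var x $ ss ≈ var x $ ts
    eq-args : ∀ {f g ss ts} → SameTy (fun f $ ss) (fun g $ ts) → ftype f ≡ ftype g →
              f ≋ g → (∀ i → π f i ≡ π g i) → length ss ≡ length ts →
              (∀ i a b → π f i ≡ true → ss ‼ i ≡ just a → ts ‼ i ≡ just b → a ≈ b) →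
              fun f $ ss ≈ fun g $ ts

  Saturated : Fun → List Tm → Set
  Saturated f ss = ∀ i → length ss < i → i ≤ arity (ftype f) → π f i ≡ true

  data _⊒_ : Tm → Tm → Set
  data _⊐_ : Tm → Tm → Set
  data _⊐⊐_ : Tm → Tm → Set

  data _⊒_ where
    ge-eq : ∀ {s t} → s ≈ t → s ⊒ t
    ge-gr : ∀ {s t} → s ⊐ t → s ⊒ t

  data _⊐_ where
    gr-mono : ∀ {x ss ts} → SameTy (var x $ ss) (var x $ ts) → length ss ≡ length ts →
              (∀ i a b → ss ‼ i ≡ just a → ts ‼ i ≡ just b → a ⊒ b) →
              Σ ℕ (λ i → Σ Tm λ a → Σ Tm λ b →
                 (ss ‼ i ≡ just a) × (ts ‼ i ≡ just b) × (a ⊐ b)) →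
              var x $ ss ⊐ var x $ ts
    gr-args : ∀ {f g ss ts} → SameTy (fun f $ ss) (fun g $ ts) → ftype f ≡ ftype g →
              f ≋ g → (∀ i → π f i ≡ π g i) → length ss ≡ length ts →
              (∀ i a b → π f i ≡ true → ss ‼ i ≡ just a → ts ‼ i ≡ just b → a ⊒ b) →
              Σ ℕ (λ i → Σ Tm λ a → Σ Tm λ b →
                 (π f i ≡ true) × (ss ‼ i ≡ just a) × (ts ‼ i ≡ just b) × (a ⊐ b)) →
              fun f $ ss ⊐ fun g $ ts
    gr-rpo  : ∀ {s t} → SameTy s t → s ⊐⊐ t → s ⊐ t

  data _⊐⊐_ where
    rpo-select : ∀ {f ss t} → Saturated f ss →
                 (i : ℕ) (a : Tm) → π f i ≡ true → ss ‼ i ≡ just a → a ⊒ t →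
                 fun f $ ss ⊐⊐ t
    -- t = t₀ t₁ ⋯ tₖ with k ≥ 1, where t₀ = h pre and t₁ ⋯ tₖ = p ∷ ps
    rpo-appl   : ∀ {f ss h pre p ps} → Saturated f ss →
                 fun f $ ss ⊐⊐ h $ pre →
                 All (λ u → fun f $ ss ⊐⊐ u) (p ∷ ps) →
                 fun f $ ss ⊐⊐ h $ (pre ++ (p ∷ ps))
    rpo-copy   : ∀ {f ss g ts} → Saturated f ss → f ▷ g →
                 (∀ i c → π g i ≡ true → ts ‼ i ≡ just c → fun f $ ss ⊐⊐ c) →
                 fun f $ ss ⊐⊐ fun g $ ts
    rpo-lex    : ∀ {f ss g ts} → Saturated f ss → f ≋ g →
                 (i : ℕ) (a b : Tm) → π f i ≡ true → π g i ≡ true →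
                 ss ‼ i ≡ just a → ts ‼ i ≡ just b →
                 (∀ j → 1 ≤ j → j ≤ i → π f j ≡ π g j) →
                 (∀ j a' b' → j < i → π f j ≡ true → ss ‼ j ≡ just a' → ts ‼ j ≡ just b' → a' ≈ b') →
                 a ⊐ b →
                 (∀ j c → i < j → π g j ≡ true → ts ‼ j ≡ just c → fun f $ ss ⊐⊐ c) →
                 fun f $ ss ⊐⊐ fun g $ ts

{-# OPTIONS --safe #-}
module Submission where

-- Induction on the derivation of t R u, for all four relations at once; the proof of
-- s ≈ t is only inverted, never recursed on. Equivalent terms have the same type and
-- number of arguments, heads that are equal variables or ≋-equivalent symbols with
-- the same filter, and pairwise equivalent filtered arguments. Hence every rule
-- concluding t R u can be replayed from s: premises about an argument b of t are
-- transferred to the corresponding argument a ≈ b of s by the induction hypothesis,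
-- premises t ⊐⊐ c likewise, and the precedence premises on the head of t hold for
-- the head of s since ≋ is transitive and ▷ is invariant under ≋.

open import Defs
open import Data.Nat using (zero; suc; _<_; _≤_)
open import Data.Nat.Properties using (suc-injective)
open import Data.List using (List; []; _∷_; length)
open import Data.List.Relation.Unary.All using (All; []; _∷_)
open import Data.Bool using (true)
open import Data.Maybe using (just)
open import Data.Product using (∃; _×_; _,_)
open import Relation.Binary.PropositionalEquality using (_≡_; refl; sym; trans; subst)

‼-just-length : ∀ {A : Set} (xs ys : List A) {i b} →
                length xs ≡ length ys → ys ‼ i ≡ just b → ∃ λ a → xs ‼ i ≡ just a
‼-just-length []       []       _ ()
‼-just-length (x ∷ _)  (_ ∷ _)  {suc zero}    _ _  = x , refl
‼-just-length (_ ∷ xs) (_ ∷ ys) {suc (suc i)} eq yb = ‼-just-length xs ys (suc-injective eq) yb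

module _ (S : Setting) where
  open Setting S
  open Terms S

  SpineTy-unique : ∀ {σ ts τ τ′} → SpineTy σ ts τ → SpineTy σ ts τ′ → τ ≡ τ′
  SpineTy-unique []      []      = refl
  SpineTy-unique (_ ∷ p) (_ ∷ q)  = SpineTy-unique p q

  ∶-unique : ∀ {t σ σ′} → t ∶ σ → t ∶ σ′ → σ ≡ σ′
  ∶-unique (tm p) (tm q) = SpineTy-unique p q

  SameTy-trans : ∀ {s t u} → SameTy s t → SameTy t u → SameTy s u
  SameTy-trans {s} (_ , s∶σ , t∶σ) (τ , t∶τ , u∶τ) = τ , subst (s ∶_) (∶-unique t∶σ t∶τ) s∶σ , u∶τ

  ≋-trans : ∀ {f g h} → f ≋ g → g ≋ h → f ≋ h
  ≋-trans (f⊵g , g⊵f) (g⊵h , h⊵g) = ⊵-trans f⊵g g⊵h , ⊵-trans h⊵g g⊵f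

  ≋-▷-trans : ∀ {f g h} → f ≋ g → g ▷ h → f ▷ h
  ≋-▷-trans (f⊵g , g⊵f) (g⊵h , h⋭g) = ⊵-trans f⊵g g⊵h , λ h⊵f → h⋭g (⊵-trans h⊵f f⊵g)

  ≈-var-argˡ : ∀ {x y ss ts i a} → var x $ ss ≈ var y $ ts →
               ss ‼ i ≡ just a → ∃ λ b → ts ‼ i ≡ just b × a ≈ b
  ≈-var-argˡ {ss = ss} {ts} (eq-mono _ len args) sa =
    let (b , tb) = ‼-just-length ts ss (sym len) sa in b , tb , args _ _ b sa tb

  ≈-var-argʳ : ∀ {x y ss ts i b} → var x $ ss ≈ var y $ ts →
               ts ‼ i ≡ just b → ∃ λ a → ss ‼ i ≡ just a × a ≈ b
  ≈-var-argʳ {ss = ss} {ts} (eq-mono _ len args) tb =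
    let (a , sa) = ‼-just-length ss ts len tb in a , sa , args _ a _ sa tb

  ≈-fun-π : ∀ {f g ss ts} → fun f $ ss ≈ fun g $ ts → ∀ i → π f i ≡ π g i
  ≈-fun-π (eq-args _ _ _ πf≡πg _ _) = πf≡πg

  ≈-fun-π⁻ : ∀ {f g ss ts i} → fun f $ ss ≈ fun g $ ts → π g i ≡ true → π f i ≡ true
  ≈-fun-π⁻ {i = i} e πgi = trans (≈-fun-π e i) πgi

  ≈-fun-π⁺ : ∀ {f g ss ts i} → fun f $ ss ≈ fun g $ ts → π f i ≡ true → π g i ≡ true
  ≈-fun-π⁺ {i = i} e πfi = trans (sym (≈-fun-π e i)) πfi

  ≈-fun-argˡ : ∀ {f g ss ts i a} → fun f $ ss ≈ fun g $ ts → π f i ≡ true →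
               ss ‼ i ≡ just a → ∃ λ b → ts ‼ i ≡ just b × a ≈ b
  ≈-fun-argˡ {ss = ss} {ts} (eq-args _ _ _ _ len args) πfi sa =
    let (b , tb) = ‼-just-length ts ss (sym len) sa in b , tb , args _ _ b πfi sa tb

  ≈-fun-argʳ : ∀ {f g ss ts i b} → fun f $ ss ≈ fun g $ ts → π g i ≡ true →
               ts ‼ i ≡ just b → ∃ λ a → ss ‼ i ≡ just a × a ≈ b
  ≈-fun-argʳ {ss = ss} {ts} e@(eq-args _ _ _ _ len args) πgi tb =
    let (a , sa) = ‼-just-length ss ts len tb in a , sa , args _ a _ (≈-fun-π⁻ e πgi) sa tb

  ≈-fun-≋ : ∀ {f g ss ts} → fun f $ ss ≈ fun g $ ts → f ≋ g
  ≈-fun-≋ (eq-args _ _ f≋g _ _ _) = f≋g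

  ≈-fun-Saturated : ∀ {f g ss ts} → fun f $ ss ≈ fun g $ ts → Saturated g ts → Saturated f ss
  ≈-fun-Saturated (eq-args _ ftype≡ _ πf≡πg len _) sat i len<i i≤m =
    trans (πf≡πg i) (sat i (subst (_< i) len len<i) (subst (λ σ → i ≤ arity σ) ftype≡ i≤m))

  ≈-trans        : ∀ {s t u} → s ≈ t → t ≈ u → s ≈ u
  ≈-⊒-trans      : ∀ {s t u} → s ≈ t → t ⊒ u → s ⊒ u
  ≈-⊐-trans      : ∀ {s t u} → s ≈ t → t ⊐ u → s ⊐ u
  ≈-⊐⊐-trans     : ∀ {s t u} → s ≈ t → t ⊐⊐ u → s ⊐⊐ u
  ≈-All-⊐⊐-trans : ∀ {s t us} → s ≈ t → All (t ⊐⊐_) us → All (s ⊐⊐_) us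

  ≈-trans e@(eq-mono st len _) (eq-mono tu len′ args′) =
    eq-mono (SameTy-trans st tu) (trans len len′) λ i a c sa uc →
      let (b , tb , a≈b) = ≈-var-argˡ e sa in ≈-trans a≈b (args′ i b c tb uc)
  ≈-trans e@(eq-args st ftype≡ f≋g πf≡πg len _) (eq-args tu ftype≡′ g≋h πg≡πh len′ args′) =
    eq-args (SameTy-trans st tu) (trans ftype≡ ftype≡′) (≋-trans f≋g g≋h)
            (λ i → trans (πf≡πg i) (πg≡πh i)) (trans len len′) λ i a c πfi sa uc →
      let (b , tb , a≈b) = ≈-fun-argˡ e πfi sa in ≈-trans a≈b (args′ i b c (≈-fun-π⁺ e πfi) tb uc)

  ≈-⊒-trans e (ge-eq t≈u) = ge-eq (≈-trans e t≈u)
  ≈-⊒-trans e (ge-gr t⊐u) = ge-gr (≈-⊐-trans e t⊐u)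

  ≈-⊐-trans e@(eq-mono st len _) (gr-mono tu len′ args′ (i , b , c , tb , uc , b⊐c)) =
    gr-mono (SameTy-trans st tu) (trans len len′)
      (λ i a c sa uc → let (b , tb , a≈b) = ≈-var-argˡ e sa in ≈-⊒-trans a≈b (args′ i b c tb uc))
      (let (a , sa , a≈b) = ≈-var-argʳ e tb in i , a , c , sa , uc , ≈-⊐-trans a≈b b⊐c)
  ≈-⊐-trans e@(eq-args st ftype≡ f≋g πf≡πg len _)
            (gr-args tu ftype≡′ g≋h πg≡πh len′ args′ (i , b , c , πgi , tb , uc , b⊐c)) =
    gr-args (SameTy-trans st tu) (trans ftype≡ ftype≡′) (≋-trans f≋g g≋h)
            (λ i → trans (πf≡πg i) (πg≡πh i)) (trans len len′)
      (λ i a c πfi sa uc →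
        let (b , tb , a≈b) = ≈-fun-argˡ e πfi sa in ≈-⊒-trans a≈b (args′ i b c (≈-fun-π⁺ e πfi) tb uc))
      (let (a , sa , a≈b) = ≈-fun-argʳ e πgi tb
       in i , a , c , ≈-fun-π⁻ e πgi , sa , uc , ≈-⊐-trans a≈b b⊐c)
  ≈-⊐-trans (eq-mono _ _ _) (gr-rpo _ ())
  ≈-⊐-trans e@(eq-args st _ _ _ _ _) (gr-rpo tu t⊐⊐u) = gr-rpo (SameTy-trans st tu) (≈-⊐⊐-trans e t⊐⊐u)

  ≈-⊐⊐-trans e@(eq-args _ _ _ _ _ _) (rpo-select sat i b πgi tb b⊒u) =
    let (a , sa , a≈b) = ≈-fun-argʳ e πgi tb
    in rpo-select (≈-fun-Saturated e sat) i a (≈-fun-π⁻ e πgi) sa (≈-⊒-trans a≈b b⊒u)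
  ≈-⊐⊐-trans e@(eq-args _ _ _ _ _ _) (rpo-appl sat t⊐⊐head t⊐⊐args) =
    rpo-appl (≈-fun-Saturated e sat) (≈-⊐⊐-trans e t⊐⊐head) (≈-All-⊐⊐-trans e t⊐⊐args)
  ≈-⊐⊐-trans e@(eq-args _ _ _ _ _ _) (rpo-copy sat g▷h t⊐⊐args) =
    rpo-copy (≈-fun-Saturated e sat) (≋-▷-trans (≈-fun-≋ e) g▷h)
      λ i c πhi uc → ≈-⊐⊐-trans e (t⊐⊐args i c πhi uc)
  ≈-⊐⊐-trans e@(eq-args _ _ _ _ _ _)
             (rpo-lex sat g≋h i b c πgi πhi tb uc πg≡πh-upto prefix≈ b⊐c t⊐⊐rest) =
    let (a , sa , a≈b) = ≈-fun-argʳ e πgi tb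
    in rpo-lex (≈-fun-Saturated e sat) (≋-trans (≈-fun-≋ e) g≋h) i a c (≈-fun-π⁻ e πgi) πhi sa uc
         (λ j 1≤j j≤i → trans (≈-fun-π e j) (πg≡πh-upto j 1≤j j≤i))
         (λ j a′ c′ j<i πfj sa′ uc′ →
           let (b′ , tb′ , a′≈b′) = ≈-fun-argˡ e πfj sa′
           in ≈-trans a′≈b′ (prefix≈ j b′ c′ j<i (≈-fun-π⁺ e πfj) tb′ uc′))
         (≈-⊐-trans a≈b b⊐c)
         (λ j c′ i<j πhj uc′ → ≈-⊐⊐-trans e (t⊐⊐rest j c′ i<j πhj uc′))

  ≈-All-⊐⊐-trans e []       = []
  ≈-All-⊐⊐-trans e (r ∷ rs) = ≈-⊐⊐-trans e r ∷ ≈-All-⊐⊐-trans e rs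

lemma3 : (S : Setting) → let open Terms S in
         ∀ {σ τ ρ} (s t u : Tm) → s ∶ σ → t ∶ τ → u ∶ ρ → s ≈ t →
           (t ≈ u → s ≈ u) × (t ⊒ u → s ⊒ u) × (t ⊐ u → s ⊐ u) × (t ⊐⊐ u → s ⊐⊐ u)
lemma3 S _ _ _ _ _ _ s≈t =
  ≈-trans S s≈t , ≈-⊒-trans S s≈t , ≈-⊐-trans S s≈t , ≈-⊐⊐-trans S s≈t
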